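{- Let $k\ge 0$ and let $G$ be a $k$-spanner. Then for any $(H,H')\in\Lambda_\mu(G)$ and each central vertex $c$ of $G$, all but at most two of the legs attached at $c$ have their inner edge not in $H\cup H'$, and for each such leg (whose inner edge is not in $H\cup H'$) its outer edge belongs to $H$.
   Context: All graphs are finite, simple, undirected and loopless. $\lambda(G)=\max\{|H|+|H'| : H,H' \text{ are disjoint matchings in } G\}$, $\Lambda(G)$ is the set of ordered pairs $(H,H')$ of disjoint matchings of $G$ with $|H|+|H'|=\lambda(G)$, $\mu(G)=\max\{|H| : (H,H')\in\Lambda(G)\}$, and $\Lambda_\mu(G)$ is the set of $(H,H')\in\Lambda(G)$ with $|H|=\mu(G)$. A leg attached at a vertex $c$ is a path $c\,x\,y$ with $x,y$ new vertices; $cx$ is its inner edge and $xy$ its outer edge. For an integer $k\ge 0$, a $k$-spanner is the tree obtained from two vertices $c_1,c_2$ (the central vertices) joined by an edge, by attaching $p\ge 2$ legs at $c_1$ and $q\ge 2$ legs at $c_2$, with $p+q=k+4$ (all leg vertices distinct). A $0$-spanner is called a spanner. -}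

module Defs where

open import Data.Nat using (ℕ; _+_; _≤_)
open import Data.Fin using (Fin)
open import Data.List using (List; length)
open import Data.List.Membership.Propositional using (_∈_; _∉_)
open import Data.List.Relation.Unary.Unique.Propositional using (Unique)
open import Data.Product using (_×_)
open import Data.Sum using (_⊎_)
open import Relation.Binary.PropositionalEquality using (_≡_; _≢_)
open import Relation.Nullary using (¬_)

-- Finite graphs given by a vertex type, an edge type and endpoints.
-- Edge sets (in particular matchings) are duplicate-free lists of edges;
-- their size is the list length.

record Graph : Set₁ where
  field
    V    : Set
    E    : Set
    end₁ : E → V
    end₂ : E → V

open Graph public

Incident : (G : Graph) → E G → V G → Set
Incident G e v = end₁ G e ≡ v ⊎ end₂ G e ≡ v

IsMatching : (G : Graph) → List (E G) → Set
IsMatching G H =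
  Unique H ×
  (∀ e f → e ∈ H → f ∈ H → e ≢ f → ∀ v → Incident G e v → ¬ Incident G f v)

DisjMatchings : (G : Graph) → List (E G) → List (E G) → Set
DisjMatchings G H H' =
  IsMatching G H × IsMatching G H' × (∀ e → e ∈ H → e ∉ H')

InΛ : (G : Graph) → List (E G) → List (E G) → Set
InΛ G H H' =
  DisjMatchings G H H' ×
  (∀ K K' → DisjMatchings G K K' → length K + length K' ≤ length H + length H')

InΛμ : (G : Graph) → List (E G) → List (E G) → Set
InΛμ G H H' =
  InΛ G H H' × (∀ K K' → InΛ G K K' → length K ≤ length H)

-- The spanner with p legs at central vertex c₁ and q legs at c₂.

data Side : Set where
  one two : Side

legs : ℕ → ℕ → Side → ℕ
legs p q one = p
legs p q two = q

data SpV (p q : ℕ) : Set where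
  ctr : Side → SpV p q
  xv  : (s : Side) → Fin (legs p q s) → SpV p q
  yv  : (s : Side) → Fin (legs p q s) → SpV p q

data SpE (p q : ℕ) : Set where
  mid   : SpE p q
  inner : (s : Side) → Fin (legs p q s) → SpE p q
  outer : (s : Side) → Fin (legs p q s) → SpE p q

spEnd₁ : ∀ {p q} → SpE p q → SpV p q
spEnd₁ mid         = ctr one
spEnd₁ (inner s i) = ctr s
spEnd₁ (outer s i) = xv s i

spEnd₂ : ∀ {p q} → SpE p q → SpV p q
spEnd₂ mid         = ctr two
spEnd₂ (inner s i) = xv s i
spEnd₂ (outer s i) = yv s i

spanner : ℕ → ℕ → Graph
spanner p q = record { V = SpV p q ; E = SpE p q ; end₁ = spEnd₁ ; end₂ = spEnd₂ }

module Submission where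

-- Two facts about an arbitrary graph G carry the argument.
--   (1) A matching has at most one edge at any vertex.  At a central vertex c
--       all inner edges meet, so H and H' each contain at most one inner edge
--       at c; hence at most two legs at c have their inner edge in H ∪ H'.
--   (2) If (H , H') ∈ Λ_μ(G), then H is a maximal matching: no edge e ∉ H can
--       be added to H.  Otherwise either e ∉ H' and (e ∷ H , H') beats λ(G),
--       or e ∈ H' and moving e from H' to H keeps |H|+|H'| = λ(G) while
--       increasing |H|, contradicting the choice of μ(G).
-- In the spanner, the only edges meeting the outer edge of a leg are that
-- outer edge and the leg's inner edge.  So if the inner edge lies outside
-- H ∪ H' and the outer edge were not in H, it could be added to H,
-- contradicting (2).

open import Defs
open import Data.Nat using (ℕ; _+_; _≤_; suc; z≤n; s≤s)
open import Data.Nat.Properties using (≤-trans; ≤-reflexive; +-mono-≤; +-suc; n≮n)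
open import Data.Fin using (Fin) renaming (_≟_ to _≟Fin_)
open import Data.Fin.Properties using (any?)
open import Data.List using (List; length; []; _∷_; _++_)
open import Data.List.Properties using (length-++; length-removeAt′)
open import Data.List.Membership.Propositional using (_∈_; _∉_)
open import Data.List.Membership.Propositional.Properties using (∈-++⁺ˡ; ∈-++⁺ʳ)
open import Data.List.Relation.Unary.Any using (here; there; _─_; index)
import Data.List.Relation.Unary.All as All
open import Data.List.Relation.Unary.All.Properties using (─⁺)
open import Data.List.Relation.Unary.AllPairs using (_∷_)
open import Data.List.Relation.Unary.Unique.Propositional using (Unique)
open import Data.Product using (_×_; ∃; ∃-syntax; _,_; proj₁)
open import Data.Sum using (_⊎_; inj₁; inj₂)
open import Data.Empty using (⊥-elim)
open import Relation.Nullary using (¬_; yes; no; Dec)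
open import Relation.Nullary.Decidable using (map′; ¬¬-excluded-middle)
open import Relation.Binary.PropositionalEquality using (_≡_; refl; sym; cong; subst; _≢_)
open import Relation.Binary.Definitions using (DecidableEquality)

module _ {A : Set} {v : A} where

  ∈-─⁻ : ∀ {e} (xs : List A) (m : v ∈ xs) → e ∈ (xs ─ m) → e ∈ xs
  ∈-─⁻ (x ∷ xs) (here _)  e∈         = there e∈
  ∈-─⁻ (x ∷ xs) (there m) (here e≡x) = here e≡x
  ∈-─⁻ (x ∷ xs) (there m) (there e∈) = there (∈-─⁻ xs m e∈)

  Unique-─ : (xs : List A) (m : v ∈ xs) → Unique xs → Unique (xs ─ m)
  Unique-─ (x ∷ xs) (here _)  (_ ∷ u)  = u
  Unique-─ (x ∷ xs) (there m) (x≢ ∷ u) = ─⁺ m x≢ ∷ Unique-─ xs m u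

  ∉-─ : (xs : List A) (m : v ∈ xs) → Unique xs → v ∉ (xs ─ m)
  ∉-─ (x ∷ xs) (here refl) (x≢ ∷ _) v∈          = All.lookup x≢ v∈ refl
  ∉-─ (x ∷ xs) (there m)   (x≢ ∷ _) (here refl) = All.lookup x≢ m refl
  ∉-─ (x ∷ xs) (there m)   (_ ∷ u)  (there v∈)  = ∉-─ xs m u v∈

-- P is covered by a list of at most n elements (so P has at most n witnesses).
CoveredBy : {B : Set} → ℕ → (B → Set) → Set
CoveredBy n P = ∃[ S ] (length S ≤ n × (∀ i → P i → i ∈ S))

cover-by-singleton : {B : Set} {P : B → Set} → Dec (∃ P) →
  (∀ i j → P i → P j → i ≡ j) → CoveredBy 1 P
cover-by-singleton (yes (i , Pi)) unique = i ∷ [] , s≤s z≤n , λ j Pj → here (unique j i Pj Pi)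
cover-by-singleton (no ¬∃P)       _      = [] , z≤n , λ j Pj → ⊥-elim (¬∃P (j , Pj))

cover-⊎ : {B : Set} {P Q : B → Set} {m n : ℕ} →
  CoveredBy m P → CoveredBy n Q → CoveredBy (m + n) (λ i → P i ⊎ Q i)
cover-⊎ (S , |S|≤m , coverP) (S' , |S'|≤n , coverQ) =
  S ++ S' ,
  ≤-trans (≤-reflexive (length-++ S)) (+-mono-≤ |S|≤m |S'|≤n) ,
  λ { i (inj₁ Pi) → ∈-++⁺ˡ (coverP i Pi)
    ; i (inj₂ Qi) → ∈-++⁺ʳ S (coverQ i Qi) }

module _ (G : Graph) where

  Avoids : E G → List (E G) → Set
  Avoids e H = ∀ f → f ∈ H → ∀ v → Incident G e v → ¬ Incident G f v

  matching-at-vertex : DecidableEquality (E G) → ∀ {H e f v} → IsMatching G H →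
    e ∈ H → f ∈ H → Incident G e v → Incident G f v → e ≡ f
  matching-at-vertex _≟_ {e = e} {f} (_ , disjoint) e∈ f∈ e∋v f∋v with e ≟ f
  ... | yes e≡f = e≡f
  ... | no  e≢f = ⊥-elim (disjoint e f e∈ f∈ e≢f _ e∋v f∋v)

  extend-matching : ∀ {H e} → IsMatching G H → e ∉ H → Avoids e H →
    IsMatching G (e ∷ H)
  extend-matching {H} {e} (unique , disjoint) e∉H avoids =
    All.tabulate (λ f∈H e≡f → e∉H (subst (_∈ H) (sym e≡f) f∈H)) ∷ unique , disjoint′
    where
      disjoint′ : ∀ f g → f ∈ e ∷ H → g ∈ e ∷ H → f ≢ g →
        ∀ v → Incident G f v → ¬ Incident G g v
      disjoint′ f g (here refl) (here refl) f≢g  = ⊥-elim (f≢g refl)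
      disjoint′ f g (here refl) (there g∈)  _ v  = avoids g g∈ v
      disjoint′ f g (there f∈)  (here refl) _ v f∋v g∋v = avoids f f∈ v g∋v f∋v
      disjoint′ f g (there f∈)  (there g∈)  f≢g = disjoint f g f∈ g∈ f≢g

  submatching : ∀ {H K} → IsMatching G H → Unique K → (∀ {e} → e ∈ K → e ∈ H) →
    IsMatching G K
  submatching (_ , disjoint) unique K⊆H =
    unique , λ e f e∈ f∈ → disjoint e f (K⊆H e∈) (K⊆H f∈)

  InΛ-by-size : ∀ {H H' K K'} → InΛ G H H' → DisjMatchings G K K' →
    length H + length H' ≤ length K + length K' → InΛ G K K'
  InΛ-by-size (_ , maxΛ) dK λ≤ = dK , λ L L' dL → ≤-trans (maxΛ L L' dL) λ≤

  Λμ-maximal : ∀ {H H' e} → InΛμ G H H' → e ∉ H → ¬ IsMatching G (e ∷ H)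
  Λμ-maximal {H} {H'} {e} (ΛHH'@((_ , mH' , disj) , maxΛ) , maxμ) e∉H mEH =
    ¬¬-excluded-middle λ
      { (no  e∉H') → n≮n _ (maxΛ (e ∷ H) H' (mEH , mH' , add-disj e∉H'))
      ; (yes e∈H') → n≮n _ (maxμ (e ∷ H) (H' ─ e∈H') (move e∈H'))
      }
    where
      add-disj : e ∉ H' → ∀ f → f ∈ e ∷ H → f ∉ H'
      add-disj e∉H' f (here refl) = e∉H'
      add-disj e∉H' f (there f∈H) = disj f f∈H

      move : (e∈H' : e ∈ H') → InΛ G (e ∷ H) (H' ─ e∈H')
      move e∈H' = InΛ-by-size ΛHH' (mEH , mK' , disjK) (≤-reflexive sizes)
        where
          uH' : Unique H'
          uH' = proj₁ mH'
          mK' : IsMatching G (H' ─ e∈H')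
          mK' = submatching mH' (Unique-─ H' e∈H' uH') (∈-─⁻ H' e∈H')
          disjK : ∀ f → f ∈ e ∷ H → f ∉ (H' ─ e∈H')
          disjK f (here refl) = ∉-─ H' e∈H' uH'
          disjK f (there f∈H) f∈K' = disj f f∈H (∈-─⁻ H' e∈H' f∈K')
          sizes : length H + length H' ≡ suc (length H) + length (H' ─ e∈H')
          sizes rewrite length-removeAt′ H' (index e∈H') = +-suc (length H) _

_≟Side_ : DecidableEquality Side
one ≟Side one = yes refl
one ≟Side two = no λ ()
two ≟Side one = no λ ()
two ≟Side two = yes refl

module _ {p q : ℕ} where

  private
    Sp : Graph
    Sp = spanner p q

  _≟E_ : DecidableEquality (SpE p q)
  mid       ≟E mid       = yes refl
  inner s i ≟E inner t j with s ≟Side t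
  ... | no  s≢t  = no λ { refl → s≢t refl }
  ... | yes refl = map′ (cong (inner s)) (λ { refl → refl }) (i ≟Fin j)
  outer s i ≟E outer t j with s ≟Side t
  ... | no  s≢t  = no λ { refl → s≢t refl }
  ... | yes refl = map′ (cong (outer s)) (λ { refl → refl }) (i ≟Fin j)
  mid       ≟E inner _ _ = no λ ()
  mid       ≟E outer _ _ = no λ ()
  inner _ _ ≟E mid       = no λ ()
  inner _ _ ≟E outer _ _ = no λ ()
  outer _ _ ≟E mid       = no λ ()
  outer _ _ ≟E inner _ _ = no λ ()

  open import Data.List.Membership.DecPropositional _≟E_ using (_∈?_)

  -- A matching contains the inner edge of at most one leg at c, since all
  -- these edges meet at the central vertex c.
  inner-unique : ∀ {M} (c : Side) → IsMatching Sp M →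
    ∀ i j → inner c i ∈ M → inner c j ∈ M → i ≡ j
  inner-unique c mM i j i∈ j∈
    with matching-at-vertex Sp _≟E_ mM i∈ j∈ (inj₁ refl) (inj₁ refl)
  ... | refl = refl

  legs-in-matching : ∀ {M} (c : Side) → IsMatching Sp M →
    CoveredBy 1 (λ i → inner c i ∈ M)
  legs-in-matching {M} c mM =
    cover-by-singleton (any? (λ i → inner c i ∈? M)) (inner-unique c mM)

  edges-at-xv : ∀ {c i} f → Incident Sp f (xv c i) → f ≡ inner c i ⊎ f ≡ outer c i
  edges-at-xv mid         (inj₁ ())
  edges-at-xv mid         (inj₂ ())
  edges-at-xv (inner s j) (inj₁ ())
  edges-at-xv (inner s j) (inj₂ refl) = inj₁ refl
  edges-at-xv (outer s j) (inj₁ refl) = inj₂ refl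
  edges-at-xv (outer s j) (inj₂ ())

  edges-at-yv : ∀ {c i} f → Incident Sp f (yv c i) → f ≡ outer c i
  edges-at-yv mid         (inj₁ ())
  edges-at-yv mid         (inj₂ ())
  edges-at-yv (inner s j) (inj₁ ())
  edges-at-yv (inner s j) (inj₂ ())
  edges-at-yv (outer s j) (inj₁ ())
  edges-at-yv (outer s j) (inj₂ refl) = refl

  outer-avoids : ∀ {M} c i → outer c i ∉ M → inner c i ∉ M → Avoids Sp (outer c i) M
  outer-avoids c i o∉ i∉ f f∈ _ (inj₁ refl) f∋x with edges-at-xv f f∋x
  ... | inj₁ refl = i∉ f∈
  ... | inj₂ refl = o∉ f∈
  outer-avoids c i o∉ i∉ f f∈ _ (inj₂ refl) f∋y with edges-at-yv f f∋y
  ... | refl = o∉ f∈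

  outer-in-H : ∀ {H H'} → InΛμ Sp H H' → ∀ c i →
    inner c i ∉ H → inner c i ∉ H' → outer c i ∈ H
  outer-in-H {H} Λμ@(((mH , _) , _) , _) c i i∉H _ with outer c i ∈? H
  ... | yes o∈H = o∈H
  ... | no  o∉H = ⊥-elim (Λμ-maximal Sp Λμ o∉H
          (extend-matching Sp mH o∉H (outer-avoids c i o∉H i∉H)))

lemma3p2 : (k p q : ℕ) → 2 ≤ p → 2 ≤ q → p + q ≡ k + 4 →
    (H H' : List (SpE p q)) → InΛμ (spanner p q) H H' →
    (c : Side) →
      (∃[ S ] (length S ≤ 2 ×
        (∀ (i : Fin (legs p q c)) → (inner c i ∈ H ⊎ inner c i ∈ H') → i ∈ S)))
      ×
      (∀ (i : Fin (legs p q c)) → inner c i ∉ H → inner c i ∉ H' → outer c i ∈ H)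
lemma3p2 k p q _ _ _ H H' Λμ@(((mH , mH' , _) , _) , _) c =
  cover-⊎ (legs-in-matching c mH) (legs-in-matching c mH') ,
  outer-in-H Λμ c
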